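{- For any world-pointed inquisitive modal model $\mathcal{M},w$ over a finite set of atomic propositions $P$, and for any $n \in \mathbb{N}$, there is a formula $\chi^n_{\mathcal{M},w} \in\textsc{InqML}$ of modal depth $n$ such that for all world-pointed models $\mathcal{M}',w'$: $\mathcal{M}',w' \models \chi^n_{\mathcal{M},w} \iff \mathcal{M}',w'\sim^n \mathcal{M},w$.
   Context: An inquisitive modal model $\mathcal{M}=\langle W,\Sigma,V\rangle$ has a set of worlds $W$, a map $\Sigma$ assigning to each world a non-empty downward-closed set of subsets of $W$, and a valuation $V\colon P\to\wp(W)$; $\sigma(w):=\bigcup\Sigma(w)$. $\textsc{InqML}$ formulae: $\phi::= p\mid\bot\mid\phi\land\phi\mid\phi\to\phi\mid\phi\mathbin{\bar{\vee}}\phi\mid\Box\phi\mid\boxplus\phi$, with $\mathbin{\bar{\vee}}$ inquisitive disjunction, $\neg\phi:=\phi\to\bot$, $\phi\lor\psi:=\neg(\neg\phi\land\neg\psi)$. Support at states $s\subseteq W$: $s\models p$ iff $s\subseteq V(p)$; $s\models\bot$ iff $s=\emptyset$; $\land$ componentwise; $s\models\phi\to\psi$ iff every $t\subseteq s$ supporting $\phi$ supports $\psi$; $s\models\phi\mathbin{\bar{\vee}}\psi$ iff $s$ supports $\phi$ or $\psi$; $s\models\Box\phi$ iff $\sigma(w)\models\phi$ for all $w\in s$; $s\models\boxplus\phi$ iff every $t\in\Sigma(w)$, $w\in s$, supports $\phi$. Truth at a world $w$ means support at $\{w\}$. $\mathcal{M},w\sim^n\mathcal{M}',w'$ means player II wins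 the $n$-round inquisitive bisimulation game from $\langle w,w'\rangle$: rounds alternate world-positions and state-positions; from $\langle w,w'\rangle$ player I chooses a state in $\Sigma(w)$ or $\Sigma'(w')$ and II a state in the other world's inquisitive state; from $\langle s,s'\rangle$ I chooses a world in one state and II a world in the other; II loses if stuck or at a world-position whose worlds disagree on an atom, and otherwise wins. -}

module Defs where

open import Level using (Level; Lift) renaming (suc to lsuc; zero to lzero)
open import Data.Nat using (ℕ; zero; suc; _⊔_)
open import Data.Fin using (Fin)
open import Data.Empty using (⊥)
open import Data.Product using (_×_; ∃; ∃-syntax)
open import Data.Sum using (_⊎_)
open import Relation.Binary.PropositionalEquality using (_≡_)

-- Atomic propositions: a finite set P, represented as Fin k.

data Form (k : ℕ) : Set where
  atom : Fin k → Form k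
  ⊥'   : Form k
  _∧'_ : Form k → Form k → Form k
  _⇒_  : Form k → Form k → Form k
  _⩖_  : Form k → Form k → Form k
  □_   : Form k → Form k
  ⊞_   : Form k → Form k

¬'_ : ∀ {k} → Form k → Form k
¬' φ = φ ⇒ ⊥'

_∨'_ : ∀ {k} → Form k → Form k → Form k
φ ∨' ψ = ¬' ((¬' φ) ∧' (¬' ψ))

md : ∀ {k} → Form k → ℕ
md (atom _) = zero
md ⊥' = zero
md (φ ∧' ψ) = md φ ⊔ md ψ
md (φ ⇒ ψ) = md φ ⊔ md ψ
md (φ ⩖ ψ) = md φ ⊔ md ψ
md (□ φ) = suc (md φ)
md (⊞ φ) = suc (md φ)

-- Subsets (states) of W are predicates W → Set.
_⊆_ : ∀ {a b} {W : Set} → (W → Set a) → (W → Set b) → Set (a Level.⊔ b)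
t ⊆ s = ∀ v → t v → s v

record Model (k : ℕ) : Set₁ where
  field
    W    : Set
    Σᴹ   : W → (W → Set) → Set
    V    : Fin k → W → Set
    Σ-nonempty   : ∀ w → ∃[ s ] Σᴹ w s
    Σ-downclosed : ∀ w (s t : W → Set) → t ⊆ s → Σᴹ w s → Σᴹ w t

module _ {k : ℕ} (M : Model k) where
  open Model M

  σ : W → W → Set₁
  σ w v = ∃[ s ] (Σᴹ w s × s v)

  Lv : Level → Level
  Lv ℓ = lsuc ℓ Level.⊔ lsuc (lsuc lzero)

  supp : ∀ {ℓ} → (W → Set ℓ) → Form k → Set (Lv ℓ)
  supp {ℓ} s (atom p) = Lift (Lv ℓ) (∀ v → s v → V p v)
  supp {ℓ} s ⊥' = Lift (Lv ℓ) (∀ v → s v → ⊥)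
  supp s (φ ∧' ψ) = supp s φ × supp s ψ
  supp {ℓ} s (φ ⇒ ψ) = ∀ (t : W → Set ℓ) → t ⊆ s → supp t φ → supp t ψ
  supp s (φ ⩖ ψ) = supp s φ ⊎ supp s ψ
  supp {ℓ} s (□ φ) = Lift (Lv ℓ) (∀ v → s v → supp (σ v) φ)
  supp {ℓ} s (⊞ φ) = Lift (Lv ℓ) (∀ v → s v → ∀ (t : W → Set) → Σᴹ v t → supp t φ)

  _⊩_ : W → Form k → Set (Lv lzero)
  w ⊩ φ = supp (λ v → v ≡ w) φ

-- n-round inquisitive bisimulation game: II has a winning strategy from ⟨w,w'⟩.
module _ {k : ℕ} (M M' : Model k) where
  private
    module M  = Model M
    module M' = Model M'

  AtomEq : M.W → M'.W → Set
  AtomEq w w' = ∀ p → (M.V p w → M'.V p w') × (M'.V p w' → M.V p w)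

  mutual
    Bisim : ℕ → M.W → M'.W → Set₁
    Bisim zero w w' = Lift (lsuc lzero) (AtomEq w w')
    Bisim (suc n) w w' =
      Lift (lsuc lzero) (AtomEq w w')
      × (∀ s → M.Σᴹ w s → ∃[ s' ] (M'.Σᴹ w' s' × StBisim n s s'))
      × (∀ s' → M'.Σᴹ w' s' → ∃[ s ] (M.Σᴹ w s × StBisim n s s'))

    -- state position ⟨s, s'⟩ with n rounds remaining after it
    StBisim : ℕ → (M.W → Set) → (M'.W → Set) → Set₁
    StBisim n s s' =
      (∀ v → s v → ∃[ v' ] (s' v' × Bisim n v v'))
      × (∀ v' → s' v' → ∃[ v ] (s v × Bisim n v v'))

_,_∼[_]_,_ : ∀ {k} (M : Model k) → Model.W M → ℕ → (M' : Model k) → Model.W M' → Set₁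
M , w ∼[ n ] M' , w' = Bisim M M' n w w'

-- Worlds of all models realise only finitely many depth-n types up to n-bisimilarity, each
-- named by a formula from a finite list of candidates built by induction on n.  The type of a
-- state s is the set of candidates characterising one of its worlds, and T(w) is the set of
-- types of the states in Σ(w).  A world w is then characterised at depth n + 1 by its
-- valuation and two clauses: every t ∈ Σ(w') is covered by a type in T(w), that is
-- ⊞ ⩖_{A ∈ T(w)} ⋁ A, and every type in T(w) is realised by some t ∈ Σ(w'), that is
-- ⋀_{A ∈ T(w)} ¬ ⊞ ⩖_{χ ∈ A} ¬ χ.  Downward closure of Σ turns a state with
-- partners for all its worlds into one matching the other state world by world, which is the
-- back-and-forth condition of the game.  Conjoining the depth-n tautology ⊞ⁿ⊤ makes the depth
-- exactly n.  The argument is classical throughout.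
module Submission where

open import Defs
open import Level using (Level; Lift; lift; lower)
open import Data.Nat using (ℕ; zero; suc; _⊔_; _≤_; z≤n; s≤s)
open import Data.Nat.Properties using (⊔-lub; ≤-trans; m≤n⇒m⊔n≡n)
open import Data.Fin using (Fin)
open import Data.Product using (∃-syntax; _×_; _,_; proj₁; proj₂; swap)
open import Data.Product.Function.NonDependent.Propositional using (_×-⇔_)
open import Data.Sum using (_⊎_; inj₁; inj₂)
open import Data.Empty using (⊥; ⊥-elim)
open import Data.List using (List; []; _∷_; [_]; _++_; map; filter; cartesianProductWith; allFin)
open import Data.List.Membership.Propositional using (_∈_)
open import Data.List.Membership.Propositional.Properties
  using (∈-++⁺ˡ; ∈-++⁺ʳ; ∈-map⁺; ∈-filter⁺; ∈-filter⁻; ∈-allFin;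
         ∈-cartesianProductWith⁺)
open import Data.List.Relation.Unary.Any using (here; there)
open import Data.List.Relation.Unary.All as All using (All; []; _∷_; lookup)
open import Data.List.Relation.Unary.All.Properties using (++⁺; map⁺; cartesianProductWith⁺)
open import Relation.Binary.PropositionalEquality using (_≡_; refl; sym; trans; cong; subst; setoid)
open import Relation.Nullary using (yes; no; ¬_)
open import Relation.Nullary.Decidable using (True; toWitness; fromWitness; decidable-stable)
open import Relation.Unary using (Decidable)
open import Function using (_∘_)
open import Function.Bundles using (_⇔_; mk⇔; Equivalence)
open import Axiom.ExcludedMiddle using (ExcludedMiddle)

open Equivalence using (to; from)

module _ {a} {A : Set a} where

  sublists : List A → List (List A)
  sublists [] = [ [] ]
  sublists (x ∷ xs) = sublists xs ++ map (x ∷_) (sublists xs)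

  filter∈sublists : ∀ {p} {P : A → Set p} (P? : Decidable P) xs → filter P? xs ∈ sublists xs
  filter∈sublists P? [] = here refl
  filter∈sublists P? (x ∷ xs) with P? x
  ... | yes _ = ∈-++⁺ʳ (sublists xs) (∈-map⁺ (x ∷_) (filter∈sublists P? xs))
  ... | no _  = ∈-++⁺ˡ (filter∈sublists P? xs)

  All-sublists : ∀ {p} {P : A → Set p} {xs} → All P xs → All (All P) (sublists xs)
  All-sublists [] = [] ∷ []
  All-sublists (px ∷ pxs) = ++⁺ (All-sublists pxs) (map⁺ (All.map (px ∷_) (All-sublists pxs)))

module _ {k : ℕ} where

  ⊤' : Form k
  ⊤' = ⊥' ⇒ ⊥'

  ⊞ⁿ⊤ : ℕ → Form k
  ⊞ⁿ⊤ zero = ⊤'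
  ⊞ⁿ⊤ (suc n) = ⊞ (⊞ⁿ⊤ n)

  module _ {a} {A : Set a} where

    ⋀ : (A → Form k) → List A → Form k
    ⋀ f [] = ⊤'
    ⋀ f (x ∷ xs) = f x ∧' ⋀ f xs

    ⩖⋁ : (A → Form k) → List A → Form k
    ⩖⋁ f [] = ⊥'
    ⩖⋁ f (x ∷ xs) = f x ⩖ ⩖⋁ f xs

  ⋁ : List (Form k) → Form k
  ⋁ = ¬'_ ∘ ⋀ ¬'_

  -- The empty list needs its own clause: ⩖ of the empty list would be ⊥', which the
  -- empty state, always in Σ(w), supports.
  ◇ : List (Form k) → Form k
  ◇ [] = ⊤'
  ◇ A@(_ ∷ _) = ¬' (⊞ (⩖⋁ ¬'_ A))

  md-⊞ⁿ⊤ : ∀ n → md (⊞ⁿ⊤ n) ≡ n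
  md-⊞ⁿ⊤ zero = refl
  md-⊞ⁿ⊤ (suc n) = cong suc (md-⊞ⁿ⊤ n)

  md-¬ : ∀ {m} (φ : Form k) → md φ ≤ m → md (¬' φ) ≤ m
  md-¬ φ h = ⊔-lub h z≤n

  module _ {a} {A : Set a} {f : A → Form k} {m : ℕ} where

    md-⋀ : ∀ {xs} → All (λ x → md (f x) ≤ m) xs → md (⋀ f xs) ≤ m
    md-⋀ [] = z≤n
    md-⋀ (h ∷ hs) = ⊔-lub h (md-⋀ hs)

    md-⩖⋁ : ∀ {xs} → All (λ x → md (f x) ≤ m) xs → md (⩖⋁ f xs) ≤ m
    md-⩖⋁ [] = z≤n
    md-⩖⋁ (h ∷ hs) = ⊔-lub h (md-⩖⋁ hs)

  md-⋁ : ∀ {m} {A : List (Form k)} → All (λ χ → md χ ≤ m) A → md (⋁ A) ≤ m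
  md-⋁ {A = A} hs = md-¬ (⋀ ¬'_ A) (md-⋀ (All.map (λ {χ} → md-¬ χ) hs))

  md-◇ : ∀ {m} {A : List (Form k)} → All (λ χ → md χ ≤ m) A → md (◇ A) ≤ suc m
  md-◇ [] = z≤n
  md-◇ {A = A@(_ ∷ _)} hs = md-¬ (⊞ (⩖⋁ ¬'_ A)) (s≤s (md-⩖⋁ (All.map (λ {χ} → md-¬ χ) hs)))

  valuations : List (Fin k) → List (Form k)
  valuations [] = [ ⊤' ]
  valuations (p ∷ ps) = cartesianProductWith _∧'_ (atom p ∷ ¬' atom p ∷ []) (valuations ps)

  stepFormula : Form k → List (List (Form k)) → Form k
  stepFormula a T = a ∧' ((⊞ (⩖⋁ ⋁ T)) ∧' ⋀ ◇ T)

  candidates : ℕ → List (Form k)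
  candidates zero = valuations (allFin k)
  candidates (suc n) =
    cartesianProductWith stepFormula (valuations (allFin k)) (sublists (sublists (candidates n)))

  md-valuations : ∀ ps → All (λ χ → md χ ≤ 0) (valuations ps)
  md-valuations [] = z≤n ∷ []
  md-valuations (p ∷ ps) = cartesianProductWith⁺ (setoid _) (setoid _) _∧'_ _ _ literal∧valuation
    where
    literal∧valuation : ∀ {l χ} → l ∈ atom p ∷ ¬' atom p ∷ [] → χ ∈ valuations ps
                      → md (l ∧' χ) ≤ 0
    literal∧valuation (here refl) χ∈ = lookup (md-valuations ps) χ∈
    literal∧valuation (there (here refl)) χ∈ = lookup (md-valuations ps) χ∈

  md-stepFormula : ∀ {n} a T → md a ≤ 0 → All (All (λ χ → md χ ≤ n)) T
                 → md (stepFormula a T) ≤ suc n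
  md-stepFormula a T a≤0 hs =
    ⊔-lub (≤-trans a≤0 z≤n) (⊔-lub (s≤s (md-⩖⋁ (All.map md-⋁ hs))) (md-⋀ (All.map md-◇ hs)))

  md-candidates : ∀ n → All (λ χ → md χ ≤ n) (candidates n)
  md-candidates zero = md-valuations (allFin k)
  md-candidates (suc n) =
    cartesianProductWith⁺ (setoid _) (setoid _) stepFormula _ _
      (λ {a} {T} a∈ T∈ → md-stepFormula a T (lookup (md-valuations (allFin k)) a∈)
                                             (lookup (All-sublists (All-sublists (md-candidates n))) T∈))

module Classical (lem : ∀ {ℓ : Level} → ExcludedMiddle ℓ) {k : ℕ} where

  -- Resizing: classically every proposition has an equivalent in Set, its decision.
  ↓_ : ∀ {ℓ} → Set ℓ → Set
  ↓ P = True (lem {P = P})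

  ↓-intro : ∀ {ℓ} {P : Set ℓ} → P → ↓ P
  ↓-intro = fromWitness

  ↓-elim : ∀ {ℓ} {P : Set ℓ} → ↓ P → P
  ↓-elim = toWitness

  ¬¬-elim : ∀ {ℓ} {P : Set ℓ} → ¬ ¬ P → P
  ¬¬-elim = decidable-stable lem

  infix 4 _,_⊨_
  _,_⊨_ : (N : Model k) → Model.W N → Form k → Set₂
  N , w ⊨ φ = _⊩_ N w φ

  module _ (N : Model k) where
    open Model N

    -- Implication at s quantifies over substates of s's universe level, hence the resizing.
    supp-anti : ∀ {ℓ ℓ'} φ {s : W → Set ℓ} {t : W → Set ℓ'} → t ⊆ s → supp N s φ → supp N t φ
    supp-anti (atom p) t⊆s h = lift λ v tv → lower h v (t⊆s v tv)
    supp-anti ⊥' t⊆s h = lift λ v tv → lower h v (t⊆s v tv)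
    supp-anti (φ ∧' ψ) t⊆s (hφ , hψ) = supp-anti φ t⊆s hφ , supp-anti ψ t⊆s hψ
    supp-anti {ℓ} (φ ⇒ ψ) t⊆s h u u⊆t uφ =
      supp-anti ψ (λ v uv → lift (↓-intro uv))
        (h u↓ (λ v uv → t⊆s v (u⊆t v (↓-elim (lower uv))))
              (supp-anti φ (λ v uv → ↓-elim (lower uv)) uφ))
      where
      u↓ : W → Set ℓ
      u↓ v = Lift ℓ (↓ u v)
    supp-anti (φ ⩖ ψ) t⊆s (inj₁ h) = inj₁ (supp-anti φ t⊆s h)
    supp-anti (φ ⩖ ψ) t⊆s (inj₂ h) = inj₂ (supp-anti ψ t⊆s h)
    supp-anti (□ φ) t⊆s h = lift λ v tv → lower h v (t⊆s v tv)
    supp-anti (⊞ φ) t⊆s h = lift λ v tv → lower h v (t⊆s v tv)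

    supp⇒⊨ : ∀ {ℓ} φ {s : W → Set ℓ} {v} → supp N s φ → s v → N , v ⊨ φ
    supp⇒⊨ φ {s} h sv = supp-anti φ (λ u u≡v → subst s (sym u≡v) sv) h

    supp-⊤ : ∀ {ℓ} {s : W → Set ℓ} → supp N s ⊤'
    supp-⊤ _ _ h = h

    supp-⊞ⁿ⊤ : ∀ {ℓ} {s : W → Set ℓ} n → supp N s (⊞ⁿ⊤ n)
    supp-⊞ⁿ⊤ zero = supp-⊤
    supp-⊞ⁿ⊤ (suc n) = lift λ _ _ _ _ → supp-⊞ⁿ⊤ n

    supp-¬ : ∀ {ℓ} {s : W → Set ℓ} φ → supp N s (¬' φ) ⇔ (∀ v → s v → ¬ N , v ⊨ φ)
    supp-¬ {ℓ} {s} φ = mk⇔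
      (λ h v sv vφ → lower (h (λ u → Lift ℓ (u ≡ v)) (λ u u≡v → subst s (sym (lower u≡v)) sv)
                               (supp-anti φ (λ u → lower) vφ)) v (lift refl))
      (λ g t t⊆s tφ → lift λ u tu → g u (t⊆s u tu) (supp⇒⊨ φ tφ tu))

    ⊨-¬ : ∀ {w} φ → N , w ⊨ ¬' φ ⇔ (¬ N , w ⊨ φ)
    ⊨-¬ {w} φ = mk⇔
      (λ h → to (supp-¬ φ) h w refl)
      (λ g → from (supp-¬ φ) λ v v≡w → subst (λ u → ¬ N , u ⊨ φ) (sym v≡w) g)

    ⊨-atom : ∀ {w p} → N , w ⊨ atom p ⇔ V p w
    ⊨-atom {w} {p} = mk⇔ (λ h → lower h w refl) (λ vp → lift λ u u≡w → subst (V p) (sym u≡w) vp)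

    ⊨-⊞ : ∀ {w} φ → N , w ⊨ ⊞ φ ⇔ (∀ t → Σᴹ w t → supp N t φ)
    ⊨-⊞ {w} φ = mk⇔
      (λ h → lower h w refl)
      (λ g → lift λ v v≡w → subst (λ u → ∀ t → Σᴹ u t → supp N t φ) (sym v≡w) g)

    module _ {a} {A : Set a} {ℓ} {s : W → Set ℓ} (f : A → Form k) where

      supp-⋀ : ∀ xs → supp N s (⋀ f xs) ⇔ (∀ {x} → x ∈ xs → supp N s (f x))
      supp-⋀ [] = mk⇔ (λ _ ()) (λ _ → supp-⊤)
      supp-⋀ (x ∷ xs) = mk⇔
        (λ { (h , _) (here refl) → h ; (_ , hs) (there x∈) → to (supp-⋀ xs) hs x∈ })
        (λ g → g (here refl) , from (supp-⋀ xs) λ x∈ → g (there x∈))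

      supp-⩖⋁⁺ : ∀ {x xs} → x ∈ xs → supp N s (f x) → supp N s (⩖⋁ f xs)
      supp-⩖⋁⁺ (here refl) h = inj₁ h
      supp-⩖⋁⁺ (there x∈) h = inj₂ (supp-⩖⋁⁺ x∈ h)

      supp-⩖⋁⁻ : ∀ xs → supp N s (⩖⋁ f xs)
               → (∃[ x ] (x ∈ xs × supp N s (f x))) ⊎ (∀ v → ¬ s v)
      supp-⩖⋁⁻ [] h = inj₂ (lower h)
      supp-⩖⋁⁻ (x ∷ xs) (inj₁ h) = inj₁ (x , here refl , h)
      supp-⩖⋁⁻ (x ∷ xs) (inj₂ h) with supp-⩖⋁⁻ xs h
      ... | inj₁ (y , y∈ , hy) = inj₁ (y , there y∈ , hy)
      ... | inj₂ empty = inj₂ empty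

  Covers : (N : Model k) → List (Form k) → (Model.W N → Set) → Set₂
  Covers N A s = ∀ v → s v → ∃[ χ ] (χ ∈ A × N , v ⊨ χ)

  Realises : (N : Model k) → (Model.W N → Set) → List (Form k) → Set₂
  Realises N t A = ∀ {χ} → χ ∈ A → ∃[ v ] (t v × N , v ⊨ χ)

  module _ (N : Model k) where
    open Model N

    supp-⋁ : ∀ {s} A → supp N s (⋁ A) ⇔ Covers N A s
    supp-⋁ A = mk⇔
      (λ h v sv → ¬¬-elim λ none →
         to (supp-¬ N (⋀ ¬'_ A)) h v sv
           (from (supp-⋀ N ¬'_ A) λ {χ} χ∈ → from (⊨-¬ N χ) λ vχ → none (χ , χ∈ , vχ)))
      (λ g → from (supp-¬ N (⋀ ¬'_ A)) λ v sv v⊨⋀ →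
         let χ , χ∈ , vχ = g v sv in to (⊨-¬ N χ) (to (supp-⋀ N ¬'_ A) v⊨⋀ χ∈) vχ)

    ⊨-◇ : ∀ {w} A → N , w ⊨ ◇ A ⇔ (∃[ t ] (Σᴹ w t × Realises N t A))
    ⊨-◇ {w} [] = mk⇔ (λ _ → let t , Σt = Σ-nonempty w in t , Σt , λ ()) (λ _ → supp-⊤ N)
    ⊨-◇ {w} A@(_ ∷ _) = mk⇔ realising-state refute
      where
      realising-state : N , w ⊨ ◇ A → ∃[ t ] (Σᴹ w t × Realises N t A)
      realising-state h =
        let t , Σt , t⊭ = ¬¬-elim λ none →
              to (⊨-¬ N (⊞ (⩖⋁ ¬'_ A))) h
                (from (⊨-⊞ N (⩖⋁ ¬'_ A)) λ t Σt → ¬¬-elim λ t⊭ → none (t , Σt , t⊭))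
        in t , Σt , λ {χ} χ∈ → ¬¬-elim λ unrealised →
             t⊭ (supp-⩖⋁⁺ N ¬'_ χ∈ (from (supp-¬ N χ) λ v tv vχ → unrealised (v , tv , vχ)))

      refute : ∃[ t ] (Σᴹ w t × Realises N t A) → N , w ⊨ ◇ A
      refute (t , Σt , realised) =
        from (⊨-¬ N (⊞ (⩖⋁ ¬'_ A))) λ h →
          absurd (supp-⩖⋁⁻ N ¬'_ A (to (⊨-⊞ N (⩖⋁ ¬'_ A)) h t Σt))
        where
        absurd : (∃[ χ ] (χ ∈ A × supp N t (¬' χ))) ⊎ (∀ v → ¬ t v) → ⊥
        absurd (inj₁ (χ , χ∈ , t⊨¬χ)) =
          let v , tv , vχ = realised χ∈ in to (supp-¬ N χ) t⊨¬χ v tv vχ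
        absurd (inj₂ empty) = let v , tv , _ = realised (here refl) in empty v tv

  -- StBisim M' M n t s is Matching (Bisim M' M n) t s by definition.
  Matching : ∀ {ℓ} {A B : Set} → (A → B → Set ℓ) → (A → Set) → (B → Set) → Set ℓ
  Matching R s t = (∀ a → s a → ∃[ b ] (t b × R a b)) × (∀ b → t b → ∃[ a ] (s a × R a b))

  Σ-restrict : ∀ {ℓ} {A : Set} (N : Model k) {R : A → Model.W N → Set ℓ} {w s} {r : A → Set}
    → Model.Σᴹ N w s → (∀ a → r a → ∃[ u ] (s u × R a u))
    → ∃[ s' ] (Model.Σᴹ N w s' × Matching R r s')
  Σ-restrict N {R} {w} {s} {r} Σs partner =
    s' , Σ-downclosed w s s' (λ u → proj₁ ∘ ↓-elim) Σs , matched , λ u → proj₂ ∘ ↓-elim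
    where
    open Model N
    s' : W → Set
    s' u = ↓ (s u × ∃[ a ] (r a × R a u))
    matched : ∀ a → r a → ∃[ u ] (s' u × R a u)
    matched a ra = let u , su , Rau = partner a ra in u , ↓-intro (su , a , ra , Rau) , Rau

  Characterises : ℕ → (M : Model k) → Model.W M → Form k → Set₂
  Characterises n M w χ = ∀ M' w' → M' , w' ⊨ χ ⇔ M' , w' ∼[ n ] M , w

  Agree : (M' M : Model k) → Model.W M' → Model.W M → Fin k → Set
  Agree M' M w' w p = (Model.V M' p w' → Model.V M p w) × (Model.V M p w → Model.V M' p w')

  characteristic-literal : ∀ (M : Model k) w p
    → ∃[ l ] (l ∈ atom p ∷ ¬' atom p ∷ [] × ∀ M' w' → M' , w' ⊨ l ⇔ Agree M' M w' w p)
  characteristic-literal M w p with lem {P = Model.V M p w}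
  ... | yes vp = atom p , here refl , λ M' w' → mk⇔
    (λ h → (λ _ → vp) , (λ _ → to (⊨-atom M') h))
    (λ (_ , back) → from (⊨-atom M') (back vp))
  ... | no ¬vp = ¬' atom p , there (here refl) , λ M' w' → mk⇔
    (λ h → (λ v'p → ⊥-elim (to (⊨-¬ M' (atom p)) h (from (⊨-atom M') v'p)))
         , (λ vp → ⊥-elim (¬vp vp)))
    (λ (forth , _) → from (⊨-¬ M' (atom p)) λ h → ¬vp (forth (to (⊨-atom M') h)))

  characteristic-valuation : ∀ (M : Model k) w ps
    → ∃[ χ ] (χ ∈ valuations ps × ∀ M' w' → M' , w' ⊨ χ ⇔ (∀ {p} → p ∈ ps → Agree M' M w' w p))
  characteristic-valuation M w [] = ⊤' , here refl , λ M' w' → mk⇔ (λ _ ()) (λ _ → supp-⊤ M')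
  characteristic-valuation M w (p ∷ ps) =
    let l , l∈ , l-char = characteristic-literal M w p
        χ , χ∈ , χ-char = characteristic-valuation M w ps
    in l ∧' χ , ∈-cartesianProductWith⁺ _∧'_ l∈ χ∈ , λ M' w' → mk⇔
      (λ { (hl , _) (here refl) → to (l-char M' w') hl
         ; (_ , hχ) (there p∈) → to (χ-char M' w') hχ p∈ })
      (λ agree → from (l-char M' w') (agree (here refl))
               , from (χ-char M' w') λ p∈ → agree (there p∈))

  characteristic-zero : ∀ (M : Model k) w → ∃[ χ ] (χ ∈ candidates 0 × Characterises 0 M w χ)
  characteristic-zero M w =
    let χ , χ∈ , χ-char = characteristic-valuation M w (allFin k)
    in χ , χ∈ , λ M' w' → mk⇔
      (λ h → lift λ p → to (χ-char M' w') h (∈-allFin p))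
      (λ agree → from (χ-char M' w') λ {p} _ → lower agree p)

  module Step (n : ℕ)
              (characteristicₙ : ∀ (M : Model k) w → ∃[ χ ] (χ ∈ candidates n × Characterises n M w χ))
              (M : Model k) where
    open Model M

    Occurs : (W → Set) → Form k → Set₂
    Occurs s χ = ∃[ u ] (s u × Characterises n M u χ)

    type : (W → Set) → List (Form k)
    type s = filter (λ χ → lem {P = Occurs s χ}) (candidates n)

    ∈-type⁺ : ∀ {s u} → s u → ∃[ χ ] (χ ∈ type s × Characterises n M u χ)
    ∈-type⁺ {s} {u} su =
      let χ , χ∈ , χ-char = characteristicₙ M u
      in χ , ∈-filter⁺ (λ χ → lem {P = Occurs s χ}) χ∈ (u , su , χ-char) , χ-char

    ∈-type⁻ : ∀ {s χ} → χ ∈ type s → Occurs s χ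
    ∈-type⁻ {s} χ∈ = proj₂ (∈-filter⁻ (λ χ → lem {P = Occurs s χ}) {xs = candidates n} χ∈)

    IsTypeIn : W → List (Form k) → Set₁
    IsTypeIn w A = ∃[ s ] (Σᴹ w s × A ≡ type s)

    types : W → List (List (Form k))
    types w = filter (λ A → lem {P = IsTypeIn w A}) (sublists (candidates n))

    type∈types : ∀ {w s} → Σᴹ w s → type s ∈ types w
    type∈types {w} {s} Σs =
      ∈-filter⁺ (λ A → lem {P = IsTypeIn w A}) (filter∈sublists _ (candidates n)) (s , Σs , refl)

    ∈-types⁻ : ∀ {w A} → A ∈ types w → IsTypeIn w A
    ∈-types⁻ {w} A∈ =
      proj₂ (∈-filter⁻ (λ A → lem {P = IsTypeIn w A}) {xs = sublists (candidates n)} A∈)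

    module _ (M' : Model k) where
      private module M' = Model M'

      Covers-type⇔ : ∀ {s t} → Covers M' (type s) t
                   ⇔ (∀ u' → t u' → ∃[ u ] (s u × Bisim M' M n u' u))
      Covers-type⇔ {s} {t} = mk⇔
        (λ (covered : Covers M' (type s) t) u' tu' →
           let χ , χ∈ , u'χ = covered u' tu'
               u , su , χ-char = ∈-type⁻ χ∈
           in u , su , to (χ-char M' u') u'χ)
        (λ back u' tu' →
           let u , su , b = back u' tu'
               χ , χ∈ , χ-char = ∈-type⁺ su
           in χ , χ∈ , from (χ-char M' u') b)

      Realises-type⇔ : ∀ {s t} → Realises M' t (type s)
                     ⇔ (∀ u → s u → ∃[ u' ] (t u' × Bisim M' M n u' u))
      Realises-type⇔ {s} {t} = mk⇔
        (λ (realised : Realises M' t (type s)) u su →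
           let χ , χ∈ , χ-char = ∈-type⁺ su
               u' , tu' , u'χ = realised χ∈
           in u' , tu' , to (χ-char M' u') u'χ)
        (λ forth χ∈ →
           let u , su , χ-char = ∈-type⁻ χ∈
               u' , tu' , b = forth u su
           in u' , tu' , from (χ-char M' u') b)

      module _ {w : W} {w' : M'.W} where

        Back Forth : Set₁
        Back = ∀ t → M'.Σᴹ w' t → ∃[ s ] (Σᴹ w s × StBisim M' M n t s)
        Forth = ∀ s → Σᴹ w s → ∃[ t ] (M'.Σᴹ w' t × StBisim M' M n t s)

        back-clause : M' , w' ⊨ ⊞ (⩖⋁ ⋁ (types w)) ⇔ Back
        back-clause = mk⇔ matching-state covered
          where
          matching-state : M' , w' ⊨ ⊞ (⩖⋁ ⋁ (types w)) → Back
          matching-state h t Σt with supp-⩖⋁⁻ M' ⋁ (types w) (to (⊨-⊞ M' (⩖⋁ ⋁ (types w))) h t Σt)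
          ... | inj₁ (A , A∈ , t⊨⋁A) with ∈-types⁻ A∈
          ...   | s , Σs , refl = Σ-restrict M Σs (to Covers-type⇔ (to (supp-⋁ M' (type s)) t⊨⋁A))
          matching-state h t Σt | inj₂ empty =
            let s , Σs = Σ-nonempty w in Σ-restrict M Σs λ u' tu' → ⊥-elim (empty u' tu')

          covered : Back → M' , w' ⊨ ⊞ (⩖⋁ ⋁ (types w))
          covered back = from (⊨-⊞ M' (⩖⋁ ⋁ (types w))) λ t Σt →
            let s , Σs , (t⇉s , _) = back t Σt
            in supp-⩖⋁⁺ M' ⋁ (type∈types Σs) (from (supp-⋁ M' (type s)) (from Covers-type⇔ t⇉s))

        forth-clause : M' , w' ⊨ ⋀ ◇ (types w) ⇔ Forth
        forth-clause = mk⇔ matching-state realised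
          where
          matching-state : M' , w' ⊨ ⋀ ◇ (types w) → Forth
          matching-state h s Σs =
            let t , Σt , t-realises = to (⊨-◇ M' (type s)) (to (supp-⋀ M' ◇ (types w)) h (type∈types Σs))
                t' , Σt' , matching = Σ-restrict M' {R = λ u u' → Bisim M' M n u' u} Σt
                                                    (to Realises-type⇔ t-realises)
            in t' , Σt' , swap matching

          realised : Forth → M' , w' ⊨ ⋀ ◇ (types w)
          realised forth = from (supp-⋀ M' ◇ (types w)) ◇-holds
            where
            ◇-holds : ∀ {A} → A ∈ types w → M' , w' ⊨ ◇ A
            ◇-holds A∈ with ∈-types⁻ A∈
            ... | s , Σs , refl =
              let t , Σt , (_ , s⇉t) = forth s Σs
              in from (⊨-◇ M' (type s)) (t , Σt , from Realises-type⇔ s⇉t)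

    characteristic-suc : ∀ w → ∃[ χ ] (χ ∈ candidates (suc n) × Characterises (suc n) M w χ)
    characteristic-suc w =
      let a , a∈ , a-char = characteristic-zero M w
      in stepFormula a (types w)
       , ∈-cartesianProductWith⁺ stepFormula a∈ (filter∈sublists _ (sublists (candidates n)))
       , λ M' w' → a-char M' w' ×-⇔ (back-clause M' ×-⇔ forth-clause M')

  characteristic : ∀ n (M : Model k) w → ∃[ χ ] (χ ∈ candidates n × Characterises n M w χ)
  characteristic zero = characteristic-zero
  characteristic (suc n) M = Step.characteristic-suc n (characteristic n) M

mainTheorem2 : (lem : ∀ {ℓ : Level} → ExcludedMiddle ℓ)
    → ∀ {k : ℕ} (M : Model k) (w : Model.W M) (n : ℕ)
    → ∃[ χ ] ((md χ ≡ n)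
        × (∀ (M' : Model k) (w' : Model.W M')
             → (_⊩_ M' w' χ) ⇔ (M' , w' ∼[ n ] M , w)))
mainTheorem2 lem M w n =
  let χ , χ∈ , χ-char = characteristic n M w
  in χ ∧' ⊞ⁿ⊤ n
   , trans (cong (md χ ⊔_) (md-⊞ⁿ⊤ n)) (m≤n⇒m⊔n≡n (lookup (md-candidates n) χ∈))
   , λ M' w' → mk⇔ (to (χ-char M' w') ∘ proj₁) (λ b → from (χ-char M' w') b , supp-⊞ⁿ⊤ M' n)
  where open Classical lem
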